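{- Let $m\ge n\ge 3$ be integers. Then ${\rm rn}(K_{1,m}\Box K_{1,n})=mn+3(m+n)+1$.
   Context: $K_{1,n}$ is the star with one center adjacent to $n$ leaves; $\Box$ denotes the Cartesian product of graphs. A radio labeling of a connected graph $G$ is a map $f:V(G)\to\mathbb{Z}_{\ge 0}$ with $|f(u)-f(v)|\geq {\rm diam}(G)+1-d(u,v)$ for all distinct vertices $u,v$, where $d$ is the graph distance; its span is $\max f-\min f$, and the radio number ${\rm rn}(G)$ is the minimum span of a radio labeling of $G$. -}

module Defs where

open import Data.Nat using (ℕ; zero; suc; _+_; _*_; _∸_; _≤_; ∣_-_∣)
open import Data.Fin using (Fin)
open import Data.Product using (Σ; ∃; _×_; _,_)
open import Data.Sum using (_⊎_)
open import Relation.Binary.PropositionalEquality using (_≡_; _≢_)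

record Graph : Set₁ where
  field
    V : Set
    E : V → V → Set
open Graph public

-- The star K_{1,n}: vertex 0 is the center, vertices 1..n are the leaves.
Star : ℕ → Graph
Star n = record
  { V = Fin (suc n)
  ; E = λ x y → (x ≡ Fin.zero × y ≢ Fin.zero) ⊎ (y ≡ Fin.zero × x ≢ Fin.zero)
  }

_□_ : Graph → Graph → Graph
G □ H = record
  { V = V G × V H
  ; E = λ { (a , b) (c , d) → (E G a c × b ≡ d) ⊎ (a ≡ c × E H b d) }
  }

data Walk (G : Graph) : V G → V G → ℕ → Set where
  here : ∀ {u} → Walk G u u zero
  step : ∀ {u w v k} → E G u w → Walk G w v k → Walk G u v (suc k)

IsDist : (G : Graph) → V G → V G → ℕ → Set
IsDist G u v k = Walk G u v k × (∀ j → Walk G u v j → k ≤ j)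

IsDiam : Graph → ℕ → Set
IsDiam G D =
  (∀ u v → ∃ λ k → IsDist G u v k × k ≤ D)
  × (∃ λ u → ∃ λ v → IsDist G u v D)

IsRadioLabeling : (G : Graph) → ℕ → (V G → ℕ) → Set
IsRadioLabeling G D f =
  ∀ u v → u ≢ v → ∀ k → IsDist G u v k → D + 1 ≤ ∣ f u - f v ∣ + k

IsSpan : (G : Graph) → (V G → ℕ) → ℕ → Set
IsSpan G f s = ∃ λ u → ∃ λ v →
  (∀ w → f u ≤ f w) × (∀ w → f w ≤ f v) × s ≡ f v ∸ f u

IsRadioNumber : Graph → ℕ → Set
IsRadioNumber G r = Σ ℕ λ D → IsDiam G D
  × (∃ λ f → IsRadioLabeling G D f × IsSpan G f r)
  × (∀ f s → IsRadioLabeling G D f → IsSpan G f s → r ≤ s)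

-- Write L u for the distance from u to the centre (0,0). The diameter is 4 and
-- d(u,v) ≤ L u + L v, so if x₀, …, x_N lists the vertices by increasing label of a radio
-- labeling f, consecutive labels differ by at least 5 − L xᵢ − L xᵢ₊₁. Telescoping gives
-- f x_N − f x₀ ≥ 5N − 2 Σ L + L x₀ + L x_N, where x₀ and x_N are not both the centre; with
-- N + 1 = (m+1)(n+1) and Σ L = 2mn + m + n this is mn + 3(m+n) + 1. A labeling of that span
-- groups the vertices (i+1, j+1) into m blocks according to i − j mod m: within a block both
-- coordinates are pairwise distinct, so the vertices are at distance 4 and may get
-- consecutive labels.
module Submission where

open import Defs
open import Data.Nat using (ℕ; zero; suc; _+_; _*_; _≤_; _<_; z≤n; s≤s; _∸_; _≤?_; ∣_-_∣)
open import Data.Nat.Properties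
open import Data.Fin as Fin using (Fin; toℕ)
open import Data.Fin.Properties using (toℕ<n; toℕ-injective; ≤fromℕ; toℕ-fromℕ)
open import Data.Product using (_×_; _,_; proj₁; proj₂)
open import Data.Sum using (_⊎_; inj₁; inj₂)
open import Data.Empty using (⊥; ⊥-elim)
open import Relation.Nullary using (Dec; yes; no)
open import Relation.Binary.Definitions using (tri<; tri≈; tri>)
open import Relation.Binary.PropositionalEquality
open import Data.List using (List; []; _∷_; _++_; map; length; cartesianProduct; allFin; tabulate)
open import Data.List.Properties using (length-++; length-map; map-++; map-∘; length-tabulate)
open import Data.Nat.ListAction using (sum)
open import Data.Nat.ListAction.Properties using (sum-++; sum-↭)
open import Function using (_∘_)
open import Data.List.Relation.Unary.Linked using (Linked; _∷_)
open import Data.List.Relation.Unary.AllPairs using (AllPairs; _∷_)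
open import Data.List.Relation.Unary.All using (All; []; _∷_)
open import Data.List.Relation.Unary.Unique.Propositional using (Unique)
open import Data.List.Relation.Unary.Unique.Propositional.Properties using (cartesianProduct⁺; allFin⁺)
open import Data.List.Relation.Binary.Permutation.Propositional using (_↭_; ↭⇒↭ₛ; ↭-sym)
open import Data.List.Relation.Binary.Permutation.Propositional.Properties using (↭-length; map⁺)
open import Data.List.Relation.Binary.Permutation.Setoid.Properties using (Unique-resp-↭)
import Data.List.Sort as Sort
import Relation.Binary.Construct.On as On
open import Data.Nat.Tactic.RingSolver using (solve-∀)

walk-++ : ∀ {G : Graph} {u w v k l} → Walk G u w k → Walk G w v l → Walk G u v (k + l)
walk-++ here q = q
walk-++ (step e p) q = step e (walk-++ p q)

record IsGraphDistance (G : Graph) (d : V G → V G → ℕ) : Set where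
  field
    d-refl     : ∀ u → d u u ≡ 0
    d-edge     : ∀ {u w} → E G u w → ∀ v → d u v ≤ suc (d w v)
    d-geodesic : ∀ u v → Walk G u v (d u v)

  d≤walk+d : ∀ {u w k} → Walk G u w k → ∀ v → d u v ≤ k + d w v
  d≤walk+d here v = ≤-refl
  d≤walk+d (step e p) v = ≤-trans (d-edge e v) (s≤s (d≤walk+d p v))

  d-triangle : ∀ u w v → d u v ≤ d u w + d w v
  d-triangle u w v = d≤walk+d (d-geodesic u w) v

  d≤walk : ∀ {u v k} → Walk G u v k → d u v ≤ k
  d≤walk {v = v} {k} p = ≤-trans (d≤walk+d p v) (≤-reflexive (trans (cong (k +_) (d-refl v)) (+-identityʳ k)))

  isDist : ∀ u v → IsDist G u v (d u v)
  isDist u v = d-geodesic u v , λ j → d≤walk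

  isDist⇒≡ : ∀ {u v k} → IsDist G u v k → k ≡ d u v
  isDist⇒≡ {u} {v} (p , minimal) = ≤-antisym (minimal _ (d-geodesic u v)) (d≤walk p)

open IsGraphDistance public

_⊕_ : ∀ {A B : Set} → (A → A → ℕ) → (B → B → ℕ) → A × B → A × B → ℕ
(dA ⊕ dB) (a , b) (c , d) = dA a c + dB b d

module _ {G H : Graph} where

  walk-□ˡ : ∀ {a c k} (b : V H) → Walk G a c k → Walk (G □ H) (a , b) (c , b) k
  walk-□ˡ b here = here
  walk-□ˡ b (step e p) = step (inj₁ (e , refl)) (walk-□ˡ b p)

  walk-□ʳ : ∀ {b d k} (a : V G) → Walk H b d k → Walk (G □ H) (a , b) (a , d) k
  walk-□ʳ a here = here
  walk-□ʳ a (step e p) = step (inj₂ (refl , e)) (walk-□ʳ a p)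

  □-distance : ∀ {dG dH} → IsGraphDistance G dG → IsGraphDistance H dH → IsGraphDistance (G □ H) (dG ⊕ dH)
  □-distance {dG} {dH} isG isH = record
    { d-refl = λ { (a , b) → cong₂ _+_ (d-refl isG a) (d-refl isH b) }
    ; d-edge = edge
    ; d-geodesic = λ { (a , b) (c , d) → walk-++ (walk-□ˡ b (d-geodesic isG a c)) (walk-□ʳ c (d-geodesic isH b d)) }
    }
    where
    edge : ∀ {u w} → E (G □ H) u w → ∀ v → (dG ⊕ dH) u v ≤ suc ((dG ⊕ dH) w v)
    edge {a , b} (inj₁ (e , refl)) (x , y) = +-monoˡ-≤ (dH b y) (d-edge isG e x)
    edge {a , b} {.a , d} (inj₂ (refl , e)) (x , y) =
      ≤-trans (+-monoʳ-≤ (dG a x) (d-edge isH e y)) (≤-reflexive (+-suc (dG a x) (dH d y)))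

module _ {k : ℕ} where

  starDist : Fin (suc k) → Fin (suc k) → ℕ
  starDist Fin.zero    Fin.zero    = 0
  starDist Fin.zero    (Fin.suc _) = 1
  starDist (Fin.suc _) Fin.zero    = 1
  starDist (Fin.suc a) (Fin.suc b) with a Fin.≟ b
  ... | yes _ = 0
  ... | no  _ = 2

  starDist-leaves : ∀ {a b : Fin k} → a ≢ b → starDist (Fin.suc a) (Fin.suc b) ≡ 2
  starDist-leaves {a} {b} a≢b with a Fin.≟ b
  ... | yes a≡b = ⊥-elim (a≢b a≡b)
  ... | no  _   = refl

  starDist≤2 : ∀ a b → starDist a b ≤ 2
  starDist≤2 Fin.zero    Fin.zero    = z≤n
  starDist≤2 Fin.zero    (Fin.suc _) = s≤s z≤n
  starDist≤2 (Fin.suc _) Fin.zero    = s≤s z≤n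
  starDist≤2 (Fin.suc a) (Fin.suc b) with a Fin.≟ b
  ... | yes _ = z≤n
  ... | no  _ = ≤-refl

  starDist-sym : ∀ a b → starDist a b ≡ starDist b a
  starDist-sym Fin.zero    Fin.zero    = refl
  starDist-sym Fin.zero    (Fin.suc _) = refl
  starDist-sym (Fin.suc _) Fin.zero    = refl
  starDist-sym (Fin.suc a) (Fin.suc b) with a Fin.≟ b | b Fin.≟ a
  ... | yes _   | yes _   = refl
  ... | no  _   | no  _   = refl
  ... | yes a≡b | no  b≢a = ⊥-elim (b≢a (sym a≡b))
  ... | no  a≢b | yes b≡a = ⊥-elim (a≢b (sym b≡a))

  starDist≡0⇒≡ : ∀ {a b} → starDist a b ≡ 0 → a ≡ b
  starDist≡0⇒≡ {Fin.zero}  {Fin.zero}  _ = refl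
  starDist≡0⇒≡ {Fin.suc a} {Fin.suc b} _ with a Fin.≟ b
  starDist≡0⇒≡ {Fin.suc a} {Fin.suc b} _  | yes refl = refl
  starDist≡0⇒≡ {Fin.suc a} {Fin.suc b} () | no  _

  star-isGraphDistance : IsGraphDistance (Star k) starDist
  star-isGraphDistance = record { d-refl = refl′ ; d-edge = edge ; d-geodesic = geodesic }
    where
    refl′ : ∀ a → starDist a a ≡ 0
    refl′ Fin.zero = refl
    refl′ (Fin.suc a) with a Fin.≟ a
    ... | yes _   = refl
    ... | no  a≢a = ⊥-elim (a≢a refl)

    edge : ∀ {a c} → E (Star k) a c → ∀ x → starDist a x ≤ suc (starDist c x)
    edge (inj₁ (refl , _)) Fin.zero    = z≤n
    edge (inj₁ (refl , _)) (Fin.suc _) = s≤s z≤n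
    edge {Fin.zero}  (inj₂ (refl , c≢0)) _           = ⊥-elim (c≢0 refl)
    edge {Fin.suc _} (inj₂ (refl , _))   Fin.zero    = ≤-refl
    edge {Fin.suc a} (inj₂ (refl , _))   (Fin.suc x) = starDist≤2 (Fin.suc a) (Fin.suc x)

    geodesic : ∀ a b → Walk (Star k) a b (starDist a b)
    geodesic Fin.zero    Fin.zero    = here
    geodesic Fin.zero    (Fin.suc b) = step (inj₁ (refl , λ ())) here
    geodesic (Fin.suc a) Fin.zero    = step (inj₂ (refl , λ ())) here
    geodesic (Fin.suc a) (Fin.suc b) with a Fin.≟ b
    ... | yes refl = here
    ... | no  _    = step (inj₂ (refl , λ ())) (step (inj₁ (refl , λ ())) here)

module _ {A B : Set} where

  length-cartesianProduct : ∀ (xs : List A) (ys : List B) →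
    length (cartesianProduct xs ys) ≡ length xs * length ys
  length-cartesianProduct []       ys = refl
  length-cartesianProduct (x ∷ xs) ys = begin
    length (map (x ,_) ys ++ cartesianProduct xs ys)
      ≡⟨ length-++ (map (x ,_) ys) ⟩
    length (map (x ,_) ys) + length (cartesianProduct xs ys)
      ≡⟨ cong₂ _+_ (length-map (x ,_) ys) (length-cartesianProduct xs ys) ⟩
    length ys + length xs * length ys ∎
    where open ≡-Reasoning

  sum-map-const+ : ∀ c (h : B → ℕ) ys → sum (map (λ y → c + h y) ys) ≡ length ys * c + sum (map h ys)
  sum-map-const+ c h []       = refl
  sum-map-const+ c h (y ∷ ys) = begin
    c + h y + sum (map (λ y → c + h y) ys)   ≡⟨ cong (c + h y +_) (sum-map-const+ c h ys) ⟩
    c + h y + (length ys * c + sum (map h ys)) ≡⟨ regroup c (h y) (length ys) (sum (map h ys)) ⟩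
    (c + length ys * c) + (h y + sum (map h ys)) ∎
    where
    open ≡-Reasoning
    regroup : ∀ c a k s → c + a + (k * c + s) ≡ (c + k * c) + (a + s)
    regroup = solve-∀

  sum-map-cartesianProduct : ∀ (g : A → ℕ) (h : B → ℕ) xs ys →
    sum (map (λ p → g (proj₁ p) + h (proj₂ p)) (cartesianProduct xs ys))
      ≡ length ys * sum (map g xs) + length xs * sum (map h ys)
  sum-map-cartesianProduct g h []       ys = sym (trans (+-identityʳ (length ys * 0)) (*-zeroʳ (length ys)))
  sum-map-cartesianProduct g h (x ∷ xs) ys = begin
    sum (map F (map (x ,_) ys ++ cartesianProduct xs ys))
      ≡⟨ cong sum (map-++ F (map (x ,_) ys) (cartesianProduct xs ys)) ⟩
    sum (map F (map (x ,_) ys) ++ map F (cartesianProduct xs ys))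
      ≡⟨ sum-++ (map F (map (x ,_) ys)) _ ⟩
    sum (map F (map (x ,_) ys)) + sum (map F (cartesianProduct xs ys))
      ≡⟨ cong₂ _+_ (trans (cong sum (sym (map-∘ ys))) (sum-map-const+ (g x) h ys))
                   (sum-map-cartesianProduct g h xs ys) ⟩
    (length ys * g x + sum (map h ys)) + (length ys * sum (map g xs) + length xs * sum (map h ys))
      ≡⟨ regroup (length ys) (g x) (sum (map h ys)) (sum (map g xs)) (length xs) ⟩
    length ys * (g x + sum (map g xs)) + suc (length xs) * sum (map h ys) ∎
    where
    open ≡-Reasoning
    F : A × B → ℕ
    F p = g (proj₁ p) + h (proj₂ p)
    regroup : ∀ k a s t l → (k * a + s) + (k * t + l * s) ≡ k * (a + t) + suc l * s
    regroup = solve-∀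

sum-starDist-zero-leaves : ∀ {j} k (g : Fin k → Fin j) →
  sum (map (starDist Fin.zero) (tabulate (Fin.suc ∘ g))) ≡ k
sum-starDist-zero-leaves zero    g = refl
sum-starDist-zero-leaves (suc k) g = cong suc (sum-starDist-zero-leaves k (g ∘ Fin.suc))

last : ∀ {A : Set} → A → List A → A
last x []       = x
last _ (y ∷ ys) = last y ys

telescope-step : ∀ {fx fy fz c k lx ly lz s} →
  fx + c ≤ fy + (lx + ly) → fy + c * k + (ly + lz) ≤ fz + 2 * (ly + s) →
  fx + c * suc k + (lx + lz) ≤ fz + 2 * (lx + (ly + s))
telescope-step {fx} {fy} {fz} {c} {k} {lx} {ly} {lz} {s} first rest =
  +-cancelˡ-≤ (fy + ly) _ _ (subst₂ _≤_ (reorderˡ fx fy c k lx ly lz) (reorderʳ fy fz lx ly s)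
    (+-monoˡ-≤ lx (+-mono-≤ first rest)))
  where
  reorderˡ : ∀ fx fy c k lx ly lz →
    fx + c + (fy + c * k + (ly + lz)) + lx ≡ fy + ly + (fx + c * suc k + (lx + lz))
  reorderˡ = solve-∀
  reorderʳ : ∀ fy fz lx ly s →
    fy + (lx + ly) + (fz + 2 * (ly + s)) + lx ≡ fy + ly + (fz + 2 * (lx + (ly + s)))
  reorderʳ = solve-∀

All-last : ∀ {A : Set} {P : A → Set} y ys → All P (y ∷ ys) → P (last y ys)
All-last y []       (py ∷ [])  = py
All-last y (z ∷ zs) (_ ∷ pzs)  = All-last z zs pzs

module Telescope {A : Set} (f level : A → ℕ) (c : ℕ)
  (gap : ∀ x y → x ≢ y → f x ≤ f y → f x + c ≤ f y + (level x + level y)) where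

  telescope : ∀ x xs → Linked (λ a b → f a ≤ f b) (x ∷ xs) → AllPairs _≢_ (x ∷ xs) →
    f x + c * length xs + (level x + level (last x xs)) ≤ f (last x xs) + 2 * sum (map level (x ∷ xs))
  telescope x [] _ _ = ≤-reflexive (double (f x) (level x) c)
    where
    double : ∀ a b c → a + c * 0 + (b + b) ≡ a + 2 * (b + 0)
    double = solve-∀
  telescope x (y ∷ ys) (fx≤fy ∷ sorted) ((x≢y ∷ _) ∷ distinct) =
    telescope-step {f x} {f y} {f (last y ys)} {c} {length ys} {level x} {level y} {level (last y ys)}
      (gap x y x≢y fx≤fy) (telescope y ys sorted distinct)

span-lower-bound-arith : ∀ m n {k S fu fx fz fv l} →
  suc k ≡ suc m * suc n → S ≡ suc n * m + suc m * n → fu ≤ fx → fz ≤ fv → 1 ≤ l →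
  fx + 5 * k + l ≤ fz + 2 * S → m * n + 3 * (m + n) + 1 ≤ fv ∸ fu
span-lower-bound-arith m n {k} {S} {fu} {fx} {fz} {fv} {l} k≡ refl fu≤fx fz≤fv 1≤l chain =
  m+n≤o⇒m≤o∸n (m * n + 3 * (m + n) + 1) (+-cancelʳ-≤ (2 * S) _ _ (begin
    m * n + 3 * (m + n) + 1 + fu + 2 * S ≡⟨ expand m n fu ⟩
    fu + 5 * (m * n + m + n) + 1         ≡⟨ cong (λ t → fu + 5 * t + 1) k≡mn+m+n ⟩
    fu + 5 * k + 1                       ≤⟨ +-mono-≤ (+-monoˡ-≤ (5 * k) fu≤fx) 1≤l ⟩
    fx + 5 * k + l                       ≤⟨ chain ⟩
    fz + 2 * S                           ≤⟨ +-monoˡ-≤ (2 * S) fz≤fv ⟩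
    fv + 2 * S                           ∎))
  where
  open ≤-Reasoning
  expand : ∀ m n fu → m * n + 3 * (m + n) + 1 + fu + 2 * (suc n * m + suc m * n) ≡ fu + 5 * (m * n + m + n) + 1
  expand = solve-∀
  k≡mn+m+n : m * n + m + n ≡ k
  k≡mn+m+n = suc-injective (trans (sym (count m n)) (sym k≡))
    where
    count : ∀ m n → suc m * suc n ≡ suc (m * n + m + n)
    count = solve-∀

module StarProduct (m n : ℕ) where

  G : Graph
  G = Star m □ Star n

  dist : V G → V G → ℕ
  dist = starDist ⊕ starDist

  dist-isGraphDistance : IsGraphDistance G dist
  dist-isGraphDistance = □-distance star-isGraphDistance star-isGraphDistance

  dist-sym : ∀ u v → dist u v ≡ dist v u
  dist-sym (a , b) (c , d) = cong₂ _+_ (starDist-sym a c) (starDist-sym b d)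

  dist≤4 : ∀ u v → dist u v ≤ 4
  dist≤4 (a , b) (c , d) = +-mono-≤ (starDist≤2 a c) (starDist≤2 b d)

  dist-pos : ∀ {u v} → u ≢ v → 1 ≤ dist u v
  dist-pos {a , b} {c , d} u≢v with starDist a c in ac | starDist b d in bd
  ... | zero  | zero  = ⊥-elim (u≢v (cong₂ _,_ (starDist≡0⇒≡ ac) (starDist≡0⇒≡ bd)))
  ... | zero  | suc _ = s≤s z≤n
  ... | suc _ | _     = s≤s z≤n

  centre : V G
  centre = Fin.zero , Fin.zero

  level : V G → ℕ
  level = dist centre

  dist≤level+level : ∀ u v → dist u v ≤ level u + level v
  dist≤level+level u v = subst (λ x → dist u v ≤ x + level v) (dist-sym u centre)
    (d-triangle dist-isGraphDistance u centre v)

  diameter : 2 ≤ m → 2 ≤ n → IsDiam G 4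
  diameter (s≤s (s≤s _)) (s≤s (s≤s _)) =
    (λ u v → dist u v , isDist dist-isGraphDistance u v , dist≤4 u v) ,
    (one , one) , (two , two) , isDist dist-isGraphDistance (one , one) (two , two)
    where
    one : ∀ {k} → Fin (suc (suc k))
    one = Fin.suc Fin.zero
    two : ∀ {k} → Fin (suc (suc (suc k)))
    two = Fin.suc one

  vertices : List (V G)
  vertices = cartesianProduct (allFin (suc m)) (allFin (suc n))

  vertices-unique : Unique vertices
  vertices-unique = cartesianProduct⁺ (allFin⁺ (suc m)) (allFin⁺ (suc n))

  length-vertices : length vertices ≡ suc m * suc n
  length-vertices = trans (length-cartesianProduct (allFin (suc m)) (allFin (suc n)))
    (cong₂ _*_ (length-tabulate {n = suc m} (λ i → i)) (length-tabulate {n = suc n} (λ i → i)))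

  sum-level-vertices : sum (map level vertices) ≡ suc n * m + suc m * n
  sum-level-vertices = trans
    (sum-map-cartesianProduct (starDist Fin.zero) (starDist Fin.zero) (allFin (suc m)) (allFin (suc n)))
    (cong₂ _+_ (cong₂ _*_ (length-tabulate {n = suc n} (λ i → i)) (sum-starDist-zero-leaves m (λ i → i)))
               (cong₂ _*_ (length-tabulate {n = suc m} (λ i → i)) (sum-starDist-zero-leaves n (λ i → i))))

  level-pos : ∀ {u v} → u ≢ v → 1 ≤ level u + level v
  level-pos {u} {v} u≢v = ≤-trans (dist-pos u≢v) (dist≤level+level u v)

  module _ (f : V G → ℕ) (radio : IsRadioLabeling G 4 f) where

    labeling-gap : ∀ x y → x ≢ y → f x ≤ f y → f x + 5 ≤ f y + (level x + level y)
    labeling-gap x y x≢y fx≤fy = begin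
      f x + 5                        ≤⟨ +-monoʳ-≤ (f x) 5≤gap ⟩
      f x + ((f y ∸ f x) + dist x y) ≡⟨ sym (+-assoc (f x) _ _) ⟩
      f x + (f y ∸ f x) + dist x y   ≡⟨ cong (_+ dist x y) (m+[n∸m]≡n fx≤fy) ⟩
      f y + dist x y                 ≤⟨ +-monoʳ-≤ (f y) (dist≤level+level x y) ⟩
      f y + (level x + level y)      ∎
      where
      open ≤-Reasoning
      5≤gap : 5 ≤ (f y ∸ f x) + dist x y
      5≤gap = subst (λ t → 5 ≤ t + dist x y) (m≤n⇒∣m-n∣≡n∸m fx≤fy)
        (radio x y x≢y (dist x y) (isDist dist-isGraphDistance x y))

    open Telescope f level 5 labeling-gap
    open Sort (On.decTotalOrder ≤-decTotalOrder f)

    span-lower-bound : 1 ≤ n → ∀ s → IsSpan G f s → m * n + 3 * (m + n) + 1 ≤ s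
    span-lower-bound 1≤n s (u , v , u-min , v-max , refl) =
      from-sorted (sort vertices) (sort-↭ vertices) (sort-↗ vertices)
      where
      2≤length : ∀ {ys} → ys ↭ vertices → 2 ≤ length ys
      2≤length p = ≤-trans (*-mono-≤ (s≤s (z≤n {m})) (s≤s 1≤n))
        (≤-reflexive (sym (trans (↭-length p) length-vertices)))

      from-sorted : ∀ ys → ys ↭ vertices → Linked (λ a b → f a ≤ f b) ys →
        m * n + 3 * (m + n) + 1 ≤ f v ∸ f u
      from-sorted []           p _ with 2≤length p
      ... | ()
      from-sorted (x ∷ [])     p _ with 2≤length p
      ... | s≤s ()
      from-sorted (x ∷ y ∷ ys) p sorted =
        span-lower-bound-arith m n
          (trans (↭-length p) length-vertices) (trans (sum-↭ (map⁺ level p)) sum-level-vertices)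
          (u-min x) (v-max (last y ys)) (level-pos (All-last y ys x≢rest))
          (telescope x (y ∷ ys) sorted distinct)
        where
        distinct : AllPairs _≢_ (x ∷ y ∷ ys)
        distinct = Unique-resp-↭ (setoid _) (↭⇒↭ₛ (↭-sym p)) vertices-unique
        x≢rest : All (x ≢_) (y ∷ ys)
        x≢rest with distinct
        ... | x≢rest ∷ _ = x≢rest

≤∣-∣ˡ : ∀ {x y c} → x + c ≤ y → c ≤ ∣ x - y ∣
≤∣-∣ˡ {x} {y} {c} x+c≤y = subst (c ≤_) (sym (m≤n⇒∣m-n∣≡n∸m (≤-trans (m≤m+n x c) x+c≤y)))
  (m+n≤o⇒m≤o∸n c (subst (_≤ y) (+-comm x c) x+c≤y))

≤∣-∣ʳ : ∀ {x y c} → y + c ≤ x → c ≤ ∣ x - y ∣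
≤∣-∣ʳ {x} {y} y+c≤x = subst (_ ≤_) (∣-∣-comm y x) (≤∣-∣ˡ y+c≤x)

≢⇒1≤∣-∣ : ∀ {x y} → x ≢ y → 1 ≤ ∣ x - y ∣
≢⇒1≤∣-∣ x≢y = n≢0⇒n>0 (x≢y ∘ ∣m-n∣≡0⇒m≡n)

module Blocks (w : ℕ) where

  slot : ℕ → ℕ → ℕ
  slot r k = r * w + k

  k≤slot : ∀ {k₀ k} r → k₀ ≤ k → k₀ ≤ slot r k
  k≤slot r k₀≤k = ≤-trans k₀≤k (m≤n+m _ (r * w))

  slot-carry : ∀ r k → slot r (k + w) ≡ slot (suc r) k
  slot-carry r k = begin
    r * w + (k + w) ≡⟨ cong (r * w +_) (+-comm k w) ⟩
    r * w + (w + k) ≡⟨ sym (+-assoc (r * w) w k) ⟩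
    r * w + w + k   ≡⟨ cong (_+ k) (+-comm (r * w) w) ⟩
    w + r * w + k   ∎
    where open ≡-Reasoning

  ∣slot-slot∣ : ∀ r {r'} k k' → r ≡ r' → ∣ slot r k - slot r' k' ∣ ≡ ∣ k - k' ∣
  ∣slot-slot∣ r k k' refl = ∣m+n-m+o∣≡∣n-o∣ (r * w) k k'

  slot-later : ∀ {r r' k k' c} → r < r' → k + c ≤ k' + w → slot r k + c ≤ slot r' k'
  slot-later {r} {r'} {k} {k'} {c} r<r' k+c≤k'+w = begin
    r * w + k + c    ≡⟨ +-assoc (r * w) k c ⟩
    r * w + (k + c)  ≤⟨ +-monoʳ-≤ (r * w) k+c≤k'+w ⟩
    r * w + (k' + w) ≡⟨ slot-carry r k' ⟩
    suc r * w + k'   ≤⟨ +-monoˡ-≤ k' (*-monoˡ-≤ w r<r') ⟩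
    r' * w + k'      ∎
    where open ≤-Reasoning

  slots-apart : ∀ {r r' k k' c} → r ≢ r' → k + c ≤ k' + w → k' + c ≤ k + w →
    c ≤ ∣ slot r k - slot r' k' ∣
  slots-apart {r} {r'} r≢r' k+c≤k'+w k'+c≤k+w with <-cmp r r'
  ... | tri< r<r' _ _ = ≤∣-∣ˡ (slot-later r<r' k+c≤k'+w)
  ... | tri≈ _ r≡r' _ = ⊥-elim (r≢r' r≡r')
  ... | tri> _ _ r'<r = ≤∣-∣ʳ (slot-later r'<r k'+c≤k+w)

CyclicDiff : ℕ → ℕ → ℕ → ℕ → Set
CyclicDiff m i j r = r < m × (r + j ≡ i ⊎ r + j ≡ i + m)

module _ {m : ℕ} where

  cyclicDiff : ℕ → ℕ → ℕ
  cyclicDiff i j with j ≤? i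
  ... | yes _ = i ∸ j
  ... | no  _ = i + m ∸ j

  cyclicDiff-correct : ∀ {i j} → i < m → j < m → CyclicDiff m i j (cyclicDiff i j)
  cyclicDiff-correct {i} {j} i<m j<m with j ≤? i
  ... | yes j≤i = ≤-<-trans (m∸n≤m i j) i<m , inj₁ (m∸n+n≡m j≤i)
  ... | no  j≰i = +-cancelʳ-≤ j _ _ (begin
          suc (i + m ∸ j + j) ≡⟨ cong suc (m∸n+n≡m j≤i+m) ⟩
          suc i + m           ≤⟨ +-monoˡ-≤ m (≰⇒> j≰i) ⟩
          j + m               ≡⟨ +-comm j m ⟩
          m + j               ∎) ,
        inj₂ (m∸n+n≡m j≤i+m)
    where
    open ≤-Reasoning
    j≤i+m : j ≤ i + m
    j≤i+m = ≤-trans (<⇒≤ j<m) (m≤n+m m i)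

  private
    +m-not-below : ∀ {x y} → x ≡ y + m → x < m → ⊥
    +m-not-below {y = y} refl x<m = <⇒≱ x<m (m≤n+m m y)

  cyclicDiff-injectiveʳ : ∀ {i j j' r} → j < m → j' < m →
    CyclicDiff m i j r → CyclicDiff m i j' r → j ≡ j'
  cyclicDiff-injectiveʳ {r = r} _ _ (_ , inj₁ e) (_ , inj₁ e') = +-cancelˡ-≡ r _ _ (trans e (sym e'))
  cyclicDiff-injectiveʳ {r = r} _ _ (_ , inj₂ e) (_ , inj₂ e') = +-cancelˡ-≡ r _ _ (trans e (sym e'))
  cyclicDiff-injectiveʳ {r = r} _ j'<m (_ , inj₁ e) (_ , inj₂ e') =
    ⊥-elim (+m-not-below (+-cancelˡ-≡ r _ _ (trans e' (trans (cong (_+ m) (sym e)) (+-assoc r _ m)))) j'<m)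
  cyclicDiff-injectiveʳ {r = r} j<m _ (_ , inj₂ e) (_ , inj₁ e') =
    ⊥-elim (+m-not-below (+-cancelˡ-≡ r _ _ (trans e (trans (cong (_+ m) (sym e')) (+-assoc r _ m)))) j<m)

  cyclicDiff-injectiveˡ : ∀ {i i' j r} → i < m → i' < m →
    CyclicDiff m i j r → CyclicDiff m i' j r → i ≡ i'
  cyclicDiff-injectiveˡ _ _ (_ , inj₁ e) (_ , inj₁ e') = trans (sym e) e'
  cyclicDiff-injectiveˡ _ _ (_ , inj₂ e) (_ , inj₂ e') = +-cancelʳ-≡ m _ _ (trans (sym e) e')
  cyclicDiff-injectiveˡ i<m _ (_ , inj₁ e) (_ , inj₂ e') = ⊥-elim (+m-not-below (trans (sym e) e') i<m)
  cyclicDiff-injectiveˡ _ i'<m (_ , inj₂ e) (_ , inj₁ e') = ⊥-elim (+m-not-below (trans (sym e') e) i'<m)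

  cyclicDiff-self : ∀ {i j} → j < m → CyclicDiff m i j i → j ≡ 0
  cyclicDiff-self {i} _   (_ , inj₁ e) = +-cancelˡ-≡ i _ _ (trans e (sym (+-identityʳ i)))
  cyclicDiff-self {i} j<m (_ , inj₂ e) = ⊥-elim (<⇒≢ j<m (+-cancelˡ-≡ i _ _ e))

  cyclicDiff-suc : ∀ {i j} → 3 ≤ m → CyclicDiff m i j (suc i) → 2 ≤ j
  cyclicDiff-suc {i} {j} _   (_ , inj₁ e) = ⊥-elim (m+n≮m i j (≤-reflexive e))
  cyclicDiff-suc {i} {j} 3≤m (_ , inj₂ e) =
    ≤-pred (≤-trans 3≤m (≤-reflexive (sym (+-cancelˡ-≡ i (suc j) m (trans (+-suc i j) e)))))

≤-by-offset : ∀ {x y} d → x + d ≡ y → x ≤ y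
≤-by-offset {x} d refl = m≤m+n x d

rowLeaf-offset : ∀ n x → 4 + n + 3 ≤ 4 + x + (3 + n)
rowLeaf-offset n x = ≤-by-offset x (shuffle n x)
  where
  shuffle : ∀ n x → 4 + n + 3 + x ≡ 4 + x + (3 + n)
  shuffle = solve-∀

inner-offset : ∀ {n j} x → j < n → 3 + j + 4 ≤ 3 + x + (3 + n)
inner-offset {j = j} x j<n with m≤n⇒∃[o]m+o≡n j<n
... | t , refl = ≤-by-offset (x + t) (shuffle j x t)
  where
  shuffle : ∀ j x t → 3 + j + 4 + (x + t) ≡ 3 + x + (3 + (suc j + t))
  shuffle = solve-∀

module Labeling (m n : ℕ) (3≤n : 3 ≤ n) (n≤m : n ≤ m) where
  open StarProduct m n
  open Blocks (3 + n)

  -- Block r (of width n + 3) holds the inner vertices (i+1, j+1) with i − j ≡ r (mod m) at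
  -- offsets 3 … n+2 and the leaf (r+1, 0) at offset n + 4; the leaves (0, j+1) come after
  -- the last block, three apart.
  label : V G → ℕ
  label (Fin.zero  , Fin.zero ) = 0
  label (Fin.suc i , Fin.zero ) = slot (toℕ i) (4 + n)
  label (Fin.zero  , Fin.suc j) = slot m (4 + 3 * toℕ j)
  label (Fin.suc i , Fin.suc j) = slot (cyclicDiff {m} (toℕ i) (toℕ j)) (3 + toℕ j)

  column<m : (j : Fin n) → toℕ j < m
  column<m j = ≤-trans (toℕ<n j) n≤m

  inner-cyclicDiff : (i : Fin m) (j : Fin n) → CyclicDiff m (toℕ i) (toℕ j) (cyclicDiff (toℕ i) (toℕ j))
  inner-cyclicDiff i j = cyclicDiff-correct (toℕ<n i) (column<m j)

  rowLeaf-before-columnLeaf : ∀ (i : Fin m) x → label (Fin.suc i , Fin.zero) + 3 ≤ slot m (4 + 3 * x)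
  rowLeaf-before-columnLeaf i x = slot-later (toℕ<n i) (rowLeaf-offset n (3 * x))

  inner-before-columnLeaf : ∀ (i : Fin m) (j : Fin n) x → label (Fin.suc i , Fin.suc j) + 4 ≤ slot m (4 + 3 * x)
  inner-before-columnLeaf i j x =
    slot-later (proj₁ (inner-cyclicDiff i j)) (inner-offset (suc (3 * x)) (toℕ<n j))

  leaf-inner-apart : ∀ c {q r j} → c ≤ 4 → j < n →
    (r ≡ q → 3 + j + c ≤ 4 + n) → (r ≡ suc q → 1 + c ≤ 3 + j) →
    c ≤ ∣ slot q (4 + n) - slot r (3 + j) ∣
  leaf-inner-apart c {q} {r} {j} c≤4 j<n same-block next-block with <-cmp r q
  ... | tri< r<q _ _ = ≤∣-∣ʳ (slot-later r<q (≤-trans (+-monoʳ-≤ (3 + j) c≤4) (inner-offset (suc n) j<n)))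
  ... | tri≈ _ refl _ = subst (c ≤_) (sym (∣slot-slot∣ q (4 + n) (3 + j) refl)) (≤∣-∣ʳ (same-block refl))
  ... | tri> _ _ q<r rewrite slot-carry q 1 with m≤n⇒m<n∨m≡n q<r
  ...   | inj₁ 1+q<r = ≤∣-∣ˡ (slot-later 1+q<r (≤-trans (s≤s c≤4)
                         (+-monoʳ-≤ 3 (≤-trans (s≤s (s≤s z≤n)) (m≤n+m (3 + n) j)))))
  ...   | inj₂ refl  = subst (c ≤_) (sym (∣slot-slot∣ (suc q) 1 (3 + j) refl)) (≤∣-∣ˡ (next-block refl))

  -- A record rather than an abbreviation, so that u and v can be inferred from the goal.
  record Separated (u v : V G) : Set where
    constructor separated
    field 5≤∣-∣+dist : 5 ≤ ∣ label u - label v ∣ + dist u v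

  separated-by : ∀ {u v} c → c ≤ ∣ label u - label v ∣ → 5 ≤ c + dist u v → Separated u v
  separated-by {u} {v} c c≤∣-∣ 5≤c+d = separated (≤-trans 5≤c+d (+-monoˡ-≤ (dist u v) c≤∣-∣))

  separated-by-4 : ∀ {u v} → u ≢ v → 4 ≤ ∣ label u - label v ∣ → Separated u v
  separated-by-4 u≢v 4≤∣-∣ = separated-by 4 4≤∣-∣ (+-monoʳ-≤ 4 (dist-pos u≢v))

  separated-sym : ∀ {u v} → Separated u v → Separated v u
  separated-sym {u} {v} (separated 5≤) =
    separated (subst₂ (λ a b → 5 ≤ a + b) (∣-∣-comm (label u) (label v)) (dist-sym u v) 5≤)

  rowLeaf-inner-separated : ∀ (i i' : Fin m) (j : Fin n) → Dec (i ≡ i') →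
    Separated (Fin.suc i , Fin.zero) (Fin.suc i' , Fin.suc j)
  -- The two vertices are adjacent. The inner one lies in block i only if j = 0 and in
  -- block i + 1 only if j = m − 1 ≥ 2, so the labels are still 4 apart.
  rowLeaf-inner-separated i .i j (yes refl) =
    separated-by 4 (leaf-inner-apart 4 {toℕ i} ≤-refl (toℕ<n j) same-block next-block)
      (+-monoʳ-≤ 4 (m≤n+m 1 _))
    where
    same-block : cyclicDiff (toℕ i) (toℕ j) ≡ toℕ i → 3 + toℕ j + 4 ≤ 4 + n
    same-block r≡i = subst (λ x → 3 + x + 4 ≤ 4 + n)
      (sym (cyclicDiff-self (column<m j) (subst (CyclicDiff m _ _) r≡i (inner-cyclicDiff i j))))
      (+-monoʳ-≤ 4 3≤n)
    next-block : cyclicDiff (toℕ i) (toℕ j) ≡ suc (toℕ i) → 1 + 4 ≤ 3 + toℕ j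
    next-block r≡1+i = +-monoʳ-≤ 3
      (cyclicDiff-suc (≤-trans 3≤n n≤m) (subst (CyclicDiff m _ _) r≡1+i (inner-cyclicDiff i j)))
  rowLeaf-inner-separated i i' j (no i≢i') =
    separated-by 2
      (leaf-inner-apart 2 {toℕ i} {cyclicDiff (toℕ i') (toℕ j)} (s≤s (s≤s z≤n)) (toℕ<n j)
        (λ _ → same-block) (λ _ → m≤m+n 3 _))
      (≤-reflexive (cong (λ d → 2 + (d + 1)) (sym (starDist-leaves i≢i'))))
    where
    same-block : 3 + toℕ j + 2 ≤ 4 + n
    same-block = +-monoʳ-≤ 3 (subst (_≤ suc n) (+-comm 2 (toℕ j)) (s≤s (toℕ<n j)))

  inner-inner-separated : ∀ (i i' : Fin m) (j j' : Fin n) → (Fin.suc i , Fin.suc j) ≢ (Fin.suc i' , Fin.suc j') →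
    Separated (Fin.suc i , Fin.suc j) (Fin.suc i' , Fin.suc j')
  inner-inner-separated i i' j j' u≢v with cyclicDiff {m} (toℕ i) (toℕ j) ≟ cyclicDiff (toℕ i') (toℕ j')
  ... | no r≢r' = separated-by-4 u≢v
        (slots-apart r≢r' (inner-offset (toℕ j') (toℕ<n j)) (inner-offset (toℕ j) (toℕ<n j')))
  ... | yes r≡r' = separated-by 1 1≤∣-∣
        (≤-reflexive (cong₂ (λ a b → 1 + (a + b)) (sym (starDist-leaves i≢i'))
                                                  (sym (starDist-leaves (j≢j' ∘ cong toℕ)))))
    where
    diff' : CyclicDiff m (toℕ i') (toℕ j') (cyclicDiff (toℕ i) (toℕ j))
    diff' = subst (CyclicDiff m _ _) (sym r≡r') (inner-cyclicDiff i' j')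
    j≢j' : toℕ j ≢ toℕ j'
    j≢j' j≡j' = u≢v (cong₂ (λ a b → Fin.suc a , Fin.suc b)
      (toℕ-injective (cyclicDiff-injectiveˡ (toℕ<n i) (toℕ<n i') (inner-cyclicDiff i j)
        (subst (λ x → CyclicDiff m _ x _) (sym j≡j') diff')))
      (toℕ-injective j≡j'))
    i≢i' : i ≢ i'
    i≢i' refl = j≢j' (cyclicDiff-injectiveʳ (column<m j) (column<m j') (inner-cyclicDiff i j) diff')
    1≤∣-∣ : 1 ≤ ∣ label (Fin.suc i , Fin.suc j) - label (Fin.suc i' , Fin.suc j') ∣
    1≤∣-∣ = subst (1 ≤_)
      (sym (trans (∣slot-slot∣ (cyclicDiff (toℕ i) (toℕ j)) (3 + toℕ j) (3 + toℕ j') r≡r')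
                  (∣m+n-m+o∣≡∣n-o∣ 3 (toℕ j) (toℕ j'))))
      (≢⇒1≤∣-∣ j≢j')

  labels-separated : ∀ u v → u ≢ v → Separated u v
  labels-separated (Fin.zero , Fin.zero) (Fin.zero , Fin.zero) u≢v = ⊥-elim (u≢v refl)
  labels-separated (Fin.zero , Fin.zero) (Fin.suc i , Fin.zero) _ =
    separated-by 4 (≤∣-∣ˡ {0} (k≤slot (toℕ i) (m≤m+n 4 n))) ≤-refl
  labels-separated (Fin.zero , Fin.zero) (Fin.zero , Fin.suc j) _ =
    separated-by 4 (≤∣-∣ˡ {0} (k≤slot m (m≤m+n 4 (3 * toℕ j)))) ≤-refl
  labels-separated (Fin.zero , Fin.zero) (Fin.suc i , Fin.suc j) _ =
    separated-by 3 (≤∣-∣ˡ {0} (k≤slot (cyclicDiff (toℕ i) (toℕ j)) (m≤m+n 3 (toℕ j)))) ≤-refl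
  labels-separated (Fin.suc i , Fin.zero) (Fin.suc i' , Fin.zero) u≢v =
    separated-by 3 (slots-apart (i≢i' ∘ toℕ-injective) (rowLeaf-offset n n) (rowLeaf-offset n n))
      (≤-reflexive (cong (λ d → 3 + (d + 0)) (sym (starDist-leaves i≢i'))))
    where
    i≢i' : i ≢ i'
    i≢i' i≡i' = u≢v (cong (λ a → Fin.suc a , Fin.zero) i≡i')
  labels-separated (Fin.suc i , Fin.zero) (Fin.zero , Fin.suc j) _ =
    separated-by 3 (≤∣-∣ˡ (rowLeaf-before-columnLeaf i (toℕ j))) ≤-refl
  labels-separated (Fin.suc i , Fin.zero) (Fin.suc i' , Fin.suc j) _ =
    rowLeaf-inner-separated i i' j (i Fin.≟ i')
  labels-separated (Fin.zero , Fin.suc j) (Fin.zero , Fin.suc j') u≢v =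
    separated-by 3 (subst (3 ≤_) ∣3j-3j'∣ (*-monoʳ-≤ 3 (≢⇒1≤∣-∣ (j≢j' ∘ toℕ-injective))))
      (≤-reflexive (cong (λ d → 3 + (0 + d)) (sym (starDist-leaves j≢j'))))
    where
    j≢j' : j ≢ j'
    j≢j' j≡j' = u≢v (cong (λ b → Fin.zero , Fin.suc b) j≡j')
    ∣3j-3j'∣ : 3 * ∣ toℕ j - toℕ j' ∣ ≡ ∣ label (Fin.zero , Fin.suc j) - label (Fin.zero , Fin.suc j') ∣
    ∣3j-3j'∣ = trans (*-distribˡ-∣-∣ 3 (toℕ j) (toℕ j'))
      (sym (trans (∣slot-slot∣ m (4 + 3 * toℕ j) (4 + 3 * toℕ j') refl)
                  (∣m+n-m+o∣≡∣n-o∣ 4 (3 * toℕ j) (3 * toℕ j'))))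
  labels-separated (Fin.zero , Fin.suc j) (Fin.suc i , Fin.suc j') u≢v =
    separated-by-4 u≢v (≤∣-∣ʳ (inner-before-columnLeaf i j' (toℕ j)))
  labels-separated (Fin.suc i , Fin.suc j) (Fin.suc i' , Fin.suc j') u≢v =
    inner-inner-separated i i' j j' u≢v
  labels-separated u@(Fin.suc _ , Fin.zero)  v@(Fin.zero , Fin.zero)   u≢v =
    separated-sym (labels-separated v u (u≢v ∘ sym))
  labels-separated u@(Fin.zero , Fin.suc _)  v@(Fin.zero , Fin.zero)   u≢v =
    separated-sym (labels-separated v u (u≢v ∘ sym))
  labels-separated u@(Fin.suc _ , Fin.suc _) v@(Fin.zero , Fin.zero)   u≢v =
    separated-sym (labels-separated v u (u≢v ∘ sym))
  labels-separated u@(Fin.zero , Fin.suc _)  v@(Fin.suc _ , Fin.zero)  u≢v =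
    separated-sym (labels-separated v u (u≢v ∘ sym))
  labels-separated u@(Fin.suc _ , Fin.suc _) v@(Fin.suc _ , Fin.zero)  u≢v =
    separated-sym (labels-separated v u (u≢v ∘ sym))
  labels-separated u@(Fin.suc _ , Fin.suc _) v@(Fin.zero , Fin.suc _)  u≢v =
    separated-sym (labels-separated v u (u≢v ∘ sym))

  label-isRadioLabeling : IsRadioLabeling G 4 label
  label-isRadioLabeling u v u≢v k d-uv≡k =
    subst (λ d → 5 ≤ ∣ label u - label v ∣ + d) (sym (isDist⇒≡ dist-isGraphDistance d-uv≡k))
      (Separated.5≤∣-∣+dist (labels-separated u v u≢v))

  label-span : (jₘ : Fin n) → (∀ (j : Fin n) → toℕ j ≤ toℕ jₘ) →
    IsSpan G label (slot m (4 + 3 * toℕ jₘ))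
  label-span jₘ jₘ-max = centre , (Fin.zero , Fin.suc jₘ) , (λ _ → z≤n) , label≤ , refl
    where
    label≤ : ∀ u → label u ≤ slot m (4 + 3 * toℕ jₘ)
    label≤ (Fin.zero  , Fin.zero ) = z≤n
    label≤ (Fin.suc i , Fin.zero ) = ≤-trans (m≤m+n _ 3) (rowLeaf-before-columnLeaf i (toℕ jₘ))
    label≤ (Fin.zero  , Fin.suc j) = +-monoʳ-≤ (m * (3 + n)) (+-monoʳ-≤ 4 (*-monoʳ-≤ 3 (jₘ-max j)))
    label≤ (Fin.suc i , Fin.suc j) = ≤-trans (m≤m+n _ 4) (inner-before-columnLeaf i j (toℕ jₘ))

lastColumnLeaf-label : ∀ m n → m * (3 + suc n) + (4 + 3 * n) ≡ m * suc n + 3 * (m + suc n) + 1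
lastColumnLeaf-label = solve-∀

theorem4p1 : (m n : ℕ) → 3 ≤ n → n ≤ m →
    IsRadioNumber (Star m □ Star n) (m * n + 3 * (m + n) + 1)
theorem4p1 m (suc n) 3≤n n≤m =
  4 , diameter (≤-trans 2≤n n≤m) 2≤n ,
  (label , label-isRadioLabeling , subst (IsSpan G label) maxLabel≡ (label-span (Fin.fromℕ n) ≤fromℕ)) ,
  λ f s radio span → span-lower-bound f radio (s≤s z≤n) s span
  where
  open StarProduct m (suc n)
  open Labeling m (suc n) 3≤n n≤m
  2≤n : 2 ≤ suc n
  2≤n = ≤-trans (n≤1+n 2) 3≤n
  maxLabel≡ : m * (3 + suc n) + (4 + 3 * toℕ (Fin.fromℕ n)) ≡ m * suc n + 3 * (m + suc n) + 1
  maxLabel≡ = trans (cong (λ j → m * (3 + suc n) + (4 + 3 * j)) (toℕ-fromℕ n)) (lastColumnLeaf-label m n)
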